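{- Let $s$ be an odd positive integer such that $\mathbb{Z}_s$ has a singleton extremal coloring. Then for every integer $t\ge 2$, \[ \operatorname{aw}(\mathbb{Z}_{st},3)\ge \operatorname{aw}(\mathbb{Z}_t,3) + \operatorname{aw}(\mathbb{Z}_s,3) - 2 .\]
   Context: $\mathbb{Z}_n$ is the cyclic group of integers mod $n$. A $3$-AP in $\mathbb{Z}_n$ is a set of three distinct elements $a,a+d,a+2d$ (mod $n$), $d\not\equiv0$. An $r$-coloring is a map $\mathbb{Z}_n\to\{1,\dots,r\}$, exact if surjective; a $3$-AP is rainbow if its elements receive distinct colors. $\operatorname{aw}(\mathbb{Z}_n,3)$ is the smallest $r$ such that every exact $r$-coloring of $\mathbb{Z}_n$ contains a rainbow $3$-AP (with value $n+1$ if $n<3$). An extremal coloring of $\mathbb{Z}_n$ is an exact $(\operatorname{aw}(\mathbb{Z}_n,3)-1)$-coloring with no rainbow $3$-AP; a singleton coloring is one in which some color is used on exactly one element. -}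

module Defs where

open import Data.Nat using (ℕ; zero; suc; _+_; _*_; _∸_; _≤_; _<_)
open import Data.Nat.DivMod using (_%_; m%n<n)
open import Data.Fin using (Fin; toℕ; fromℕ<)
open import Data.Product using (Σ; _×_; ∃; ∃-syntax; _,_)
open import Relation.Binary.PropositionalEquality using (_≡_; _≢_)
open import Relation.Nullary using (¬_)

-- ℤ_n is modelled by Fin n; addition modulo n.
_⊕_ : ∀ {n} → Fin n → Fin n → Fin n
_⊕_ {suc m} x y = fromℕ< (m%n<n (toℕ x + toℕ y) (suc m))

IsZero : ∀ {n} → Fin n → Set
IsZero x = toℕ x ≡ 0

Is3AP : ∀ {n} → Fin n → Fin n → Set
Is3AP a d =
  ¬ IsZero d × (a ≢ (a ⊕ d)) × (a ≢ ((a ⊕ d) ⊕ d)) × ((a ⊕ d) ≢ ((a ⊕ d) ⊕ d))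

-- a coloring of ℤ_n with colors Fin r (colors {1..r} ↔ Fin r)
Coloring : ℕ → ℕ → Set
Coloring n r = Fin n → Fin r

Exact : ∀ {n r} → Coloring n r → Set
Exact {n} {r} c = ∀ (j : Fin r) → ∃[ x ] c x ≡ j

HasRainbow3AP : ∀ {n r} → Coloring n r → Set
HasRainbow3AP {n} c =
  ∃[ a ] ∃[ d ] (Is3AP a d ×
    (c a ≢ c (a ⊕ d)) × (c a ≢ c ((a ⊕ d) ⊕ d)) × (c (a ⊕ d) ≢ c ((a ⊕ d) ⊕ d)))

AllRainbow : ℕ → ℕ → Set
AllRainbow n r = ∀ (c : Coloring n r) → Exact c → HasRainbow3AP c

IsAW : ℕ → ℕ → Set
IsAW n k =
  (n < 3 → k ≡ suc n) ×
  (3 ≤ n → 1 ≤ k × AllRainbow n k × (∀ r → 1 ≤ r → r < k → ¬ AllRainbow n r))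

IsExtremal : ∀ {n} → (k : ℕ) → IsAW n k → Coloring n (k ∸ 1) → Set
IsExtremal k _ c = Exact c × ¬ HasRainbow3AP c

IsSingleton : ∀ {n r} → Coloring n r → Set
IsSingleton {n} {r} c = ∃[ j ] ∃[ x ] (c x ≡ j × (∀ y → c y ≡ j → y ≡ x))

HasSingletonExtremal : ℕ → Set
HasSingletonExtremal n =
  ∃[ k ] Σ (IsAW n k) λ h → ∃[ c ] (IsExtremal {n} k h c × IsSingleton c)

Odd : ℕ → Set
Odd s = ∃[ m ] s ≡ suc (2 * m)

module Submission where

-- Write x ∈ ℤ_st as x = π x + s · q x with π x ∈ ℤ_s
-- the residue and q x ∈ ℤ_t the quotient: π is a homomorphism, and q is one on
-- steps divisible by s.  Let σ be an extremal colouring of ℤ_s whose colour at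
-- x₀ is used nowhere else, and τ an exact rainbow-free colouring of ℤ_t with
-- R = aw(ℤ_t,3) − 1 colours.  Colour x by τ (q x) when π x = x₀ and by σ (π x)
-- otherwise.  This exact colouring of ℤ_st has R + aw(ℤ_s,3) − 2 colours and no
-- rainbow 3-AP: a 3-AP with π-step ≠ 0 projects to a 3-AP of ℤ_s (this uses
-- that s is odd), and one with π-step 0 lies in a single fibre of π, which is
-- monochromatic unless it is the fibre over x₀, a copy of (ℤ_t, τ).

open import Defs
open import Data.Nat
  using (ℕ; zero; suc; _+_; _*_; _∸_; _≤_; _<_; _≤?_; NonZero; >-nonZero⁻¹; z≤n; s≤s)
open import Data.Nat.Properties
open import Data.Nat.DivMod
open import Data.Nat.Divisibility using (_∣_; divides; m%n≡0⇒n∣m)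
open import Data.Fin
  using (Fin; toℕ; fromℕ<; inject≤; _↑ˡ_; _↑ʳ_; punchIn; punchOut; splitAt)
  renaming (zero to fzero; suc to fsuc; _≟_ to _≟ᶠ_)
open import Data.Fin.Properties
  using ( toℕ-fromℕ<; toℕ-injective; toℕ<n; toℕ-inject≤; any?
        ; punchOut-cong; punchOut-punchIn; punchInᵢ≢i; splitAt⁻¹-↑ˡ; splitAt⁻¹-↑ʳ)
open import Data.Product using (_×_; _,_; proj₁; proj₂; ∃-syntax)
open import Data.Sum using (inj₁; inj₂)
open import Data.Empty using (⊥; ⊥-elim)
open import Function using (_∘_)
open import Relation.Nullary using (¬_; Dec; yes; no)
open import Relation.Nullary.Decidable using (_×-dec_; ¬?)
open import Relation.Binary.PropositionalEquality
open import Relation.Binary.Definitions using (tri<; tri≈; tri>)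

-- Arithmetic of ⊕ on Fin n

toℕ-⊕ : ∀ {n} .{{_ : NonZero n}} (a b : Fin n) → toℕ (a ⊕ b) ≡ (toℕ a + toℕ b) % n
toℕ-⊕ {suc _} a b = toℕ-fromℕ< _

%-absorbˡ : ∀ X Y n .{{_ : NonZero n}} → (X % n + Y) % n ≡ (X + Y) % n
%-absorbˡ X Y n = begin
  (X % n + Y) % n           ≡⟨ %-distribˡ-+ (X % n) Y n ⟩
  (X % n % n + Y % n) % n   ≡⟨ cong (λ z → (z + Y % n) % n) (m%n%n≡m%n X n) ⟩
  (X % n + Y % n) % n       ≡⟨ %-distribˡ-+ X Y n ⟨
  (X + Y) % n               ∎
  where open ≡-Reasoning

toℕ-⊕⊕ : ∀ {n} .{{_ : NonZero n}} (a b : Fin n) →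
  toℕ ((a ⊕ b) ⊕ b) ≡ (toℕ a + (toℕ b + toℕ b)) % n
toℕ-⊕⊕ {n} a b = begin
  toℕ ((a ⊕ b) ⊕ b)               ≡⟨ toℕ-⊕ (a ⊕ b) b ⟩
  (toℕ (a ⊕ b) + toℕ b) % n        ≡⟨ cong (λ z → (z + toℕ b) % n) (toℕ-⊕ a b) ⟩
  ((toℕ a + toℕ b) % n + toℕ b) % n ≡⟨ %-absorbˡ (toℕ a + toℕ b) (toℕ b) n ⟩
  (toℕ a + toℕ b + toℕ b) % n      ≡⟨ %-congˡ (+-assoc (toℕ a) (toℕ b) (toℕ b)) ⟩
  (toℕ a + (toℕ b + toℕ b)) % n    ∎
  where open ≡-Reasoning

%-cancelˡ-∣ : ∀ U W n .{{_ : NonZero n}} → (U + W) % n ≡ U % n → n ∣ W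
%-cancelˡ-∣ U W n e = divides ((U + W) / n ∸ U / n) (begin
  W                                         ≡⟨ m+n∸m≡n U W ⟨
  (U + W) ∸ U                               ≡⟨ cong₂ _∸_ (m≡m%n+[m/n]*n (U + W) n) (m≡m%n+[m/n]*n U n) ⟩
  ((U + W) % n + (U + W) / n * n) ∸ (U % n + U / n * n)
      ≡⟨ cong (λ z → (z + (U + W) / n * n) ∸ (U % n + U / n * n)) e ⟩
  (U % n + (U + W) / n * n) ∸ (U % n + U / n * n)
      ≡⟨ [m+n]∸[m+o]≡n∸o (U % n) _ _ ⟩
  (U + W) / n * n ∸ U / n * n               ≡⟨ *-distribʳ-∸ n ((U + W) / n) (U / n) ⟨
  ((U + W) / n ∸ U / n) * n                 ∎)
  where open ≡-Reasoning

returns⇒∣ : ∀ {n} .{{_ : NonZero n}} (u : Fin n) W → (toℕ u + W) % n ≡ toℕ u → n ∣ W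
returns⇒∣ {n} u W e = %-cancelˡ-∣ (toℕ u) W n (trans e (sym (m<n⇒m%n≡m (toℕ<n u))))

∣∧<⇒≡0 : ∀ {n V} → n ∣ V → V < n → V ≡ 0
∣∧<⇒≡0 (divides zero eq) _ = eq
∣∧<⇒≡0 {n} (divides (suc k) eq) V<n =
  ⊥-elim (<⇒≱ V<n (subst (n ≤_) (sym eq) (m≤m+n n (k * n))))

-- If an odd number s divides V + V with V < s, then V = 0 (2V = s is impossible).
odd∣double⇒≡0 : ∀ m {V} → suc (2 * m) ∣ V + V → V < suc (2 * m) → V ≡ 0
odd∣double⇒≡0 m (divides zero eq) _ = m+n≡0⇒m≡0 _ eq
odd∣double⇒≡0 m {V} (divides (suc zero) eq) _ =
  ⊥-elim (even≢odd V m (trans (cong (V +_) (*-identityˡ V)) (trans eq (*-identityˡ _))))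
odd∣double⇒≡0 m {V} (divides (suc (suc k)) eq) V<s =
  ⊥-elim (<⇒≱ (+-mono-< V<s V<s) (subst (s + s ≤_) (sym eq) (+-monoʳ-≤ s (m≤m+n s (k * s)))))
  where
  s : ℕ
  s = suc (2 * m)

step-moves : ∀ {n} (u v : Fin n) → toℕ v ≢ 0 → u ≢ u ⊕ v
step-moves {suc _} u v v≢0 e =
  v≢0 (∣∧<⇒≡0 (returns⇒∣ u (toℕ v) (trans (sym (toℕ-⊕ u v)) (cong toℕ (sym e)))) (toℕ<n v))

double-step-moves : ∀ m (u v : Fin (suc (2 * m))) → toℕ v ≢ 0 → u ≢ (u ⊕ v) ⊕ v
double-step-moves m u v v≢0 e =
  v≢0 (odd∣double⇒≡0 m
        (returns⇒∣ u (toℕ v + toℕ v) (trans (sym (toℕ-⊕⊕ u v)) (cong toℕ (sym e))))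
        (toℕ<n v))

odd-3AP : ∀ m (a d : Fin (suc (2 * m))) → toℕ d ≢ 0 → Is3AP a d
odd-3AP m a d d≢0 =
  d≢0 , step-moves a d d≢0 , double-step-moves m a d d≢0 , step-moves (a ⊕ d) d d≢0

⊕-identityʳ : ∀ {n} (u v : Fin n) → toℕ v ≡ 0 → u ⊕ v ≡ u
⊕-identityʳ {suc n} u v v≡0 = toℕ-injective (begin
  toℕ (u ⊕ v)                ≡⟨ toℕ-⊕ u v ⟩
  (toℕ u + toℕ v) % suc n    ≡⟨ %-congˡ (trans (cong (toℕ u +_) v≡0) (+-identityʳ (toℕ u))) ⟩
  toℕ u % suc n              ≡⟨ m<n⇒m%n≡m (toℕ<n u) ⟩
  toℕ u                      ∎)
  where open ≡-Reasoning

-- Residue and quotient maps ℤ_st → ℤ_s, ℤ_t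

module Fibration (s t : ℕ) .{{_ : NonZero s}} .{{_ : NonZero t}} where

  instance
    st≢0 : NonZero (s * t)
    st≢0 = m*n≢0 s t
    ts≢0 : NonZero (t * s)
    ts≢0 = m*n≢0 t s

  π : Fin (s * t) → Fin s
  π x = fromℕ< (m%n<n (toℕ x) s)

  toℕ-π : ∀ x → toℕ (π x) ≡ toℕ x % s
  toℕ-π x = toℕ-fromℕ< _

  q : Fin (s * t) → Fin t
  q x = fromℕ< (m<n*o⇒m/o<n (subst (toℕ x <_) (*-comm s t) (toℕ<n x)))

  toℕ-q : ∀ x → toℕ (q x) ≡ toℕ x / s
  toℕ-q x = toℕ-fromℕ< _

  decompose : ∀ x → toℕ x ≡ toℕ (π x) + toℕ (q x) * s
  decompose x = trans (m≡m%n+[m/n]*n (toℕ x) s)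
                      (sym (cong₂ (λ a b → a + b * s) (toℕ-π x) (toℕ-q x)))

  πq-injective : ∀ x y → π x ≡ π y → q x ≡ q y → x ≡ y
  πq-injective x y eπ eq = toℕ-injective (begin
    toℕ x                       ≡⟨ decompose x ⟩
    toℕ (π x) + toℕ (q x) * s   ≡⟨ cong₂ (λ a b → toℕ a + toℕ b * s) eπ eq ⟩
    toℕ (π y) + toℕ (q y) * s   ≡⟨ decompose y ⟨
    toℕ y                       ∎)
    where open ≡-Reasoning

  π-⊕ : ∀ a b → π (a ⊕ b) ≡ π a ⊕ π b
  π-⊕ a b = toℕ-injective (begin
    toℕ (π (a ⊕ b))                  ≡⟨ toℕ-π (a ⊕ b) ⟩
    toℕ (a ⊕ b) % s                  ≡⟨ %-congˡ (toℕ-⊕ a b) ⟩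
    (toℕ a + toℕ b) % (s * t) % s    ≡⟨ m∣n⇒o%n%m≡o%m s (s * t) _ (divides t (*-comm s t)) ⟩
    (toℕ a + toℕ b) % s              ≡⟨ %-distribˡ-+ (toℕ a) (toℕ b) s ⟩
    (toℕ a % s + toℕ b % s) % s      ≡⟨ cong₂ (λ u v → (u + v) % s) (toℕ-π a) (toℕ-π b) ⟨
    (toℕ (π a) + toℕ (π b)) % s      ≡⟨ toℕ-⊕ (π a) (π b) ⟨
    toℕ (π a ⊕ π b)                  ∎)
    where open ≡-Reasoning

  q-⊕ : ∀ a b → s ∣ toℕ b → q (a ⊕ b) ≡ q a ⊕ q b
  q-⊕ a b s∣b = toℕ-injective (begin
    toℕ (q (a ⊕ b))                   ≡⟨ toℕ-q (a ⊕ b) ⟩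
    toℕ (a ⊕ b) / s                   ≡⟨ /-congˡ (toℕ-⊕ a b) ⟩
    (toℕ a + toℕ b) % (s * t) / s     ≡⟨ /-congˡ (%-congʳ (*-comm s t)) ⟩
    (toℕ a + toℕ b) % (t * s) / s     ≡⟨ m%[n*o]/o≡m/o%n (toℕ a + toℕ b) t s ⟩
    (toℕ a + toℕ b) / s % t           ≡⟨ %-congˡ (+-distrib-/-∣ʳ (toℕ a) s∣b) ⟩
    (toℕ a / s + toℕ b / s) % t       ≡⟨ cong₂ (λ u v → (u + v) % t) (toℕ-q a) (toℕ-q b) ⟨
    (toℕ (q a) + toℕ (q b)) % t       ≡⟨ toℕ-⊕ (q a) (q b) ⟨
    toℕ (q a ⊕ q b)                   ∎)
    where open ≡-Reasoning

  pair< : (p : Fin s) (z : Fin t) → toℕ p + toℕ z * s < s * t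
  pair< p z = begin-strict
    toℕ p + toℕ z * s   <⟨ +-monoˡ-< (toℕ z * s) (toℕ<n p) ⟩
    suc (toℕ z) * s     ≤⟨ *-monoˡ-≤ s (toℕ<n z) ⟩
    t * s               ≡⟨ *-comm t s ⟩
    s * t               ∎
    where open ≤-Reasoning

  pair : Fin s → Fin t → Fin (s * t)
  pair p z = fromℕ< (pair< p z)

  π-pair : ∀ p z → π (pair p z) ≡ p
  π-pair p z = toℕ-injective (begin
    toℕ (π (pair p z))        ≡⟨ toℕ-π (pair p z) ⟩
    toℕ (pair p z) % s        ≡⟨ %-congˡ (toℕ-fromℕ< (pair< p z)) ⟩
    (toℕ p + toℕ z * s) % s   ≡⟨ [m+kn]%n≡m%n (toℕ p) (toℕ z) s ⟩
    toℕ p % s                 ≡⟨ m<n⇒m%n≡m (toℕ<n p) ⟩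
    toℕ p                     ∎)
    where open ≡-Reasoning

  q-pair : ∀ p z → q (pair p z) ≡ z
  q-pair p z = toℕ-injective (begin
    toℕ (q (pair p z))              ≡⟨ toℕ-q (pair p z) ⟩
    toℕ (pair p z) / s              ≡⟨ /-congˡ (toℕ-fromℕ< (pair< p z)) ⟩
    (toℕ p + toℕ z * s) / s         ≡⟨ +-distrib-/-∣ʳ (toℕ p) (divides (toℕ z) refl) ⟩
    toℕ p / s + toℕ z * s / s       ≡⟨ cong₂ _+_ (m<n⇒m/n≡0 (toℕ<n p)) (m*n/n≡m (toℕ z) s) ⟩
    toℕ z                           ∎)
    where open ≡-Reasoning

  module Fibre (a d : Fin (s * t)) (πd≡0 : toℕ (π d) ≡ 0) where

    s∣d : s ∣ toℕ d
    s∣d = m%n≡0⇒n∣m _ s (trans (sym (toℕ-π d)) πd≡0)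

    π-second : π (a ⊕ d) ≡ π a
    π-second = trans (π-⊕ a d) (⊕-identityʳ (π a) (π d) πd≡0)

    π-third : π ((a ⊕ d) ⊕ d) ≡ π a
    π-third = trans (trans (π-⊕ (a ⊕ d) d) (⊕-identityʳ _ (π d) πd≡0)) π-second

    q-second : q (a ⊕ d) ≡ q a ⊕ q d
    q-second = q-⊕ a d s∣d

    q-third : q ((a ⊕ d) ⊕ d) ≡ (q a ⊕ q d) ⊕ q d
    q-third = trans (q-⊕ (a ⊕ d) d s∣d) (cong (_⊕ q d) q-second)

    q-3AP : Is3AP a d → Is3AP (q a) (q d)
    q-3AP (d≢0 , a≢b , a≢c , b≢c) = qd≢0 , qa≢qb , qa≢qc , qb≢qc
      where
      qd≢0 : toℕ (q d) ≢ 0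
      qd≢0 e = d≢0 (trans (decompose d) (cong₂ _+_ πd≡0 (cong (_* s) e)))
      qa≢qb : q a ≢ q a ⊕ q d
      qa≢qb e = a≢b (πq-injective a _ (sym π-second) (trans e (sym q-second)))
      qa≢qc : q a ≢ (q a ⊕ q d) ⊕ q d
      qa≢qc e = a≢c (πq-injective a _ (sym π-third) (trans e (sym q-third)))
      qb≢qc : q a ⊕ q d ≢ (q a ⊕ q d) ⊕ q d
      qb≢qc e = b≢c (πq-injective _ _ (trans π-second (sym π-third))
                                       (trans q-second (trans e (sym q-third))))

-- Rainbow-forcing colour counts and aw

DistinctColours : ∀ {n r} → Coloring n r → Fin n → Fin n → Set
DistinctColours c a d =
  (c a ≢ c (a ⊕ d)) × (c a ≢ c ((a ⊕ d) ⊕ d)) × (c (a ⊕ d) ≢ c ((a ⊕ d) ⊕ d))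

HasRainbow3AP? : ∀ {n r} (c : Coloring n r) → Dec (HasRainbow3AP c)
HasRainbow3AP? c = any? λ a → any? λ d →
  (¬? (toℕ d ≟ 0) ×-dec ¬? (a ≟ᶠ (a ⊕ d)) ×-dec ¬? (a ≟ᶠ ((a ⊕ d) ⊕ d))
                  ×-dec ¬? ((a ⊕ d) ≟ᶠ ((a ⊕ d) ⊕ d)))
  ×-dec ¬? (c a ≟ᶠ c (a ⊕ d)) ×-dec ¬? (c a ≟ᶠ c ((a ⊕ d) ⊕ d))
  ×-dec ¬? (c (a ⊕ d) ≟ᶠ c ((a ⊕ d) ⊕ d))

-- Merging colours along a surjection f cannot create rainbow 3-APs, so if x
-- colours force a rainbow 3-AP then so do y colours.
AllRainbow-coarsen : ∀ {n x y} (f : Fin y → Fin x) → (∀ j → ∃[ i ] f i ≡ j) →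
  AllRainbow n x → AllRainbow n y
AllRainbow-coarsen f f-onto all-x c c-exact = uncoarsen (all-x (f ∘ c) fc-exact)
  where
  fc-exact : Exact (f ∘ c)
  fc-exact j with f-onto j
  ... | i , fi≡j with c-exact i
  ...   | x , cx≡i = x , trans (cong f cx≡i) fi≡j
  uncoarsen : HasRainbow3AP (f ∘ c) → HasRainbow3AP c
  uncoarsen (a , d , ap , n₁ , n₂ , n₃) = a , d , ap , n₁ ∘ cong f , n₂ ∘ cong f , n₃ ∘ cong f

reduce : ∀ {y} a → Fin y → Fin (suc a)
reduce a i = fromℕ< (m%n<n (toℕ i) (suc a))

reduce-onto : ∀ {y} a → suc a ≤ y → ∀ j → ∃[ i ] reduce {y} a i ≡ j
reduce-onto a le j = inject≤ j le , toℕ-injective (begin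
  toℕ (reduce a (inject≤ j le))   ≡⟨ toℕ-fromℕ< _ ⟩
  toℕ (inject≤ j le) % suc a      ≡⟨ %-congˡ (toℕ-inject≤ j le) ⟩
  toℕ j % suc a                   ≡⟨ m<n⇒m%n≡m (toℕ<n j) ⟩
  toℕ j                           ∎)
  where open ≡-Reasoning

AllRainbow-mono : ∀ {n x y} → 1 ≤ x → x ≤ y → AllRainbow n x → AllRainbow n y
AllRainbow-mono {x = suc a} _ le = AllRainbow-coarsen (reduce a) (reduce-onto a le)

¬AllRainbow-1 : ∀ {n} → Fin n → ¬ AllRainbow n 1
¬AllRainbow-1 x all-1 with all-1 (λ _ → fzero) (λ { fzero → x , refl })
... | _ , _ , _ , different , _ = different refl

no-3AP-in-ℤ₂ : (a d : Fin 2) → ¬ Is3AP a d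
no-3AP-in-ℤ₂ a d (_ , a≢b , a≢c , b≢c) = three-distinct a (a ⊕ d) ((a ⊕ d) ⊕ d) a≢b a≢c b≢c
  where
  three-distinct : (x y z : Fin 2) → x ≢ y → x ≢ z → y ≢ z → ⊥
  three-distinct fzero         fzero         _             x≢y _   _   = x≢y refl
  three-distinct (fsuc fzero)  (fsuc fzero)  _             x≢y _   _   = x≢y refl
  three-distinct fzero         (fsuc fzero)  fzero         _   x≢z _   = x≢z refl
  three-distinct fzero         (fsuc fzero)  (fsuc fzero)  _   _   y≢z = y≢z refl
  three-distinct (fsuc fzero)  fzero         fzero         _   _   y≢z = y≢z refl
  three-distinct (fsuc fzero)  fzero         (fsuc fzero)  _   x≢z _   = x≢z refl

aw-unique : ∀ {n k k′} → IsAW n k → IsAW n k′ → k ≡ k′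
aw-unique {n} {k} {k′} (small , large) (small′ , large′) with 3 ≤? n
... | no n≱3 = trans (small (≰⇒> n≱3)) (sym (small′ (≰⇒> n≱3)))
... | yes n≥3 with large n≥3 | large′ n≥3
...   | 1≤k , all-k , minimal | 1≤k′ , all-k′ , minimal′ with <-cmp k k′
...     | tri< k<k′ _ _ = ⊥-elim (minimal′ k 1≤k k<k′ all-k)
...     | tri≈ _ k≡k′ _ = k≡k′
...     | tri> _ _ k>k′ = ⊥-elim (minimal k′ 1≤k′ k>k′ all-k′)

-- For t ≥ 2, aw(ℤ_t,3) − 1 colours do not force a rainbow 3-AP: for t = 2 the
-- identity colouring has no 3-AP at all, for t ≥ 3 this is minimality of aw
-- (and aw = 1 is excluded by the constant colouring).
¬AllRainbow-below-aw : ∀ t {k} → 2 ≤ t → IsAW t k → ¬ AllRainbow t (k ∸ 1)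
¬AllRainbow-below-aw zero ()
¬AllRainbow-below-aw (suc zero) (s≤s ())
¬AllRainbow-below-aw (suc (suc zero)) _ (small , _) with small (s≤s (s≤s (s≤s z≤n)))
... | refl = λ all-2 →
  let (a , d , ap , _) = all-2 (λ x → x) (λ j → j , refl) in no-3AP-in-ℤ₂ a d ap
¬AllRainbow-below-aw (suc (suc (suc _))) {k} _ (_ , large) with large (s≤s (s≤s (s≤s z≤n)))
... | _ , all-k , minimal with k
...   | suc zero = λ _ → ¬AllRainbow-1 fzero all-k
...   | suc (suc r) = minimal (suc r) (s≤s z≤n) ≤-refl

-- The blow-up colouring of ℤ_st

module BlowUp (m t : ℕ) .{{_ : NonZero t}} {K : ℕ}
  (σ : Fin (suc (2 * m)) → Fin (suc K)) (σ-exact : Exact σ) (σ-free : ¬ HasRainbow3AP σ)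
  (x₀ : Fin (suc (2 * m))) (σ-singleton : ∀ y → σ y ≡ σ x₀ → y ≡ x₀)
  {R : ℕ} (τ : Fin t → Fin R) where

  s : ℕ
  s = suc (2 * m)
  open Fibration s t

  -- The σ-colour of p ≠ x₀, renumbered among the K colours other than σ x₀.
  σ-rest : (p : Fin s) → p ≢ x₀ → Fin K
  σ-rest p p≢x₀ = punchOut {i = σ x₀} {j = σ p} (p≢x₀ ∘ σ-singleton p ∘ sym)

  colourAt : Fin s → Fin t → Fin (R + K)
  colourAt p z with p ≟ᶠ x₀
  ... | yes _    = τ z ↑ˡ K
  ... | no p≢x₀  = R ↑ʳ σ-rest p p≢x₀

  C : Coloring (s * t) (R + K)
  C x = colourAt (π x) (q x)

  colourAt-x₀ : ∀ z → colourAt x₀ z ≡ τ z ↑ˡ K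
  colourAt-x₀ z with x₀ ≟ᶠ x₀
  ... | yes _      = refl
  ... | no x₀≢x₀   = ⊥-elim (x₀≢x₀ refl)

  colourAt-rest : ∀ p z (p≢x₀ : p ≢ x₀) → colourAt p z ≡ R ↑ʳ σ-rest p p≢x₀
  colourAt-rest p z p≢x₀ with p ≟ᶠ x₀
  ... | yes p≡x₀ = ⊥-elim (p≢x₀ p≡x₀)
  ... | no _     = cong (R ↑ʳ_) (punchOut-cong (σ x₀) refl)

  colourAt-σ : ∀ p p′ z z′ → p ≢ x₀ → p′ ≢ x₀ → σ p ≡ σ p′ → colourAt p z ≡ colourAt p′ z′
  colourAt-σ p p′ z z′ p≢x₀ p′≢x₀ e =
    trans (colourAt-rest p z p≢x₀)
      (trans (cong (R ↑ʳ_) (punchOut-cong (σ x₀) e)) (sym (colourAt-rest p′ z′ p′≢x₀)))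

  -- Points in distinct fibres with equal σ-colour get equal C-colour, because
  -- neither fibre can be the one over x₀.
  σ-equal⇒C-equal : ∀ x y → π x ≢ π y → σ (π x) ≡ σ (π y) → C x ≡ C y
  σ-equal⇒C-equal x y πx≢πy e = colourAt-σ (π x) (π y) (q x) (q y) πx≢x₀ πy≢x₀ e
    where
    πx≢x₀ : π x ≢ x₀
    πx≢x₀ ex = πx≢πy (trans ex (sym (σ-singleton (π y) (trans (sym e) (cong σ ex)))))
    πy≢x₀ : π y ≢ x₀
    πy≢x₀ ey = πx≢πy (trans (σ-singleton (π x) (trans e (cong σ ey))) (sym ey))

  τ-equal⇒C-equal : ∀ x y → π x ≡ x₀ → π y ≡ x₀ → τ (q x) ≡ τ (q y) → C x ≡ C y
  τ-equal⇒C-equal x y ex ey e =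
    trans (cong (λ p → colourAt p (q x)) ex)
      (trans (colourAt-x₀ (q x))
        (trans (cong (_↑ˡ K) e)
          (sym (trans (cong (λ p → colourAt p (q y)) ey) (colourAt-x₀ (q y))))))

  -- C is exact: τ-colours are attained on the fibre over x₀, the others off it.
  C-exact : Exact τ → Exact C
  C-exact τ-exact c with splitAt R c in split
  ... | inj₁ i with τ-exact i
  ...   | z , τz≡i = pair x₀ z , (begin
    colourAt (π (pair x₀ z)) (q (pair x₀ z)) ≡⟨ cong₂ colourAt (π-pair x₀ z) (q-pair x₀ z) ⟩
    colourAt x₀ z                           ≡⟨ colourAt-x₀ z ⟩
    τ z ↑ˡ K                                ≡⟨ cong (_↑ˡ K) τz≡i ⟩
    i ↑ˡ K                                  ≡⟨ splitAt⁻¹-↑ˡ split ⟩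
    c                                       ∎)
    where open ≡-Reasoning
  C-exact τ-exact c | inj₂ k with σ-exact (punchIn (σ x₀) k)
  ... | p , σp≡ = pair p z₀ , (begin
    colourAt (π (pair p z₀)) (q (pair p z₀)) ≡⟨ cong₂ colourAt (π-pair p z₀) (q-pair p z₀) ⟩
    colourAt p z₀                           ≡⟨ colourAt-rest p z₀ p≢x₀ ⟩
    R ↑ʳ σ-rest p p≢x₀                       ≡⟨ cong (R ↑ʳ_) (trans (punchOut-cong (σ x₀) σp≡) (punchOut-punchIn (σ x₀))) ⟩
    R ↑ʳ k                                  ≡⟨ splitAt⁻¹-↑ʳ split ⟩
    c                                       ∎)
    where
    open ≡-Reasoning
    z₀ : Fin t
    z₀ = fromℕ< (>-nonZero⁻¹ t)
    p≢x₀ : p ≢ x₀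
    p≢x₀ p≡x₀ = punchInᵢ≢i (σ x₀) k (trans (sym σp≡) (cong σ p≡x₀))

  -- A rainbow 3-AP with nonzero residue step projects to a rainbow 3-AP of σ.
  transversal-rainbow : ∀ a d → toℕ (π d) ≢ 0 → ¬ DistinctColours C a d
  transversal-rainbow a d πd≢0 (c₁ , c₂ , c₃) =
    σ-free (π a , π d , odd-3AP m (π a) (π d) πd≢0 , f₁ , f₂ , f₃)
    where
    b c : Fin (s * t)
    b = a ⊕ d
    c = b ⊕ d
    πb : π b ≡ π a ⊕ π d
    πb = π-⊕ a d
    πc : π c ≡ (π a ⊕ π d) ⊕ π d
    πc = trans (π-⊕ b d) (cong (_⊕ π d) πb)
    πa≢πb : π a ≢ π b
    πa≢πb e = step-moves (π a) (π d) πd≢0 (trans e πb)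
    πa≢πc : π a ≢ π c
    πa≢πc e = double-step-moves m (π a) (π d) πd≢0 (trans e πc)
    πb≢πc : π b ≢ π c
    πb≢πc e = step-moves (π a ⊕ π d) (π d) πd≢0 (trans (sym πb) (trans e πc))
    f₁ : σ (π a) ≢ σ (π a ⊕ π d)
    f₁ e = c₁ (σ-equal⇒C-equal a b πa≢πb (trans e (cong σ (sym πb))))
    f₂ : σ (π a) ≢ σ ((π a ⊕ π d) ⊕ π d)
    f₂ e = c₂ (σ-equal⇒C-equal a c πa≢πc (trans e (cong σ (sym πc))))
    f₃ : σ (π a ⊕ π d) ≢ σ ((π a ⊕ π d) ⊕ π d)
    f₃ e = c₃ (σ-equal⇒C-equal b c πb≢πc (trans (cong σ πb) (trans e (cong σ (sym πc)))))

  -- A rainbow 3-AP with residue step 0 lies in one fibre; fibres other than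
  -- the one over x₀ are monochromatic, and that one carries a copy of τ.
  fibre-rainbow : ¬ HasRainbow3AP τ → ∀ a d → toℕ (π d) ≡ 0 → Is3AP a d → ¬ DistinctColours C a d
  fibre-rainbow τ-free a d πd≡0 ap (c₁ , c₂ , c₃) = by-fibre (π a ≟ᶠ x₀)
    where
    open Fibre a d πd≡0
    by-fibre : Dec (π a ≡ x₀) → ⊥
    by-fibre (no πa≢x₀) =
      c₁ (colourAt-σ (π a) (π (a ⊕ d)) (q a) (q (a ⊕ d))
            πa≢x₀ (πa≢x₀ ∘ trans (sym π-second)) (cong σ (sym π-second)))
    by-fibre (yes πa≡x₀) = τ-free (q a , q d , q-3AP ap , h₁ , h₂ , h₃)
      where
      πb≡x₀ : π (a ⊕ d) ≡ x₀
      πb≡x₀ = trans π-second πa≡x₀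
      πc≡x₀ : π ((a ⊕ d) ⊕ d) ≡ x₀
      πc≡x₀ = trans π-third πa≡x₀
      h₁ : τ (q a) ≢ τ (q a ⊕ q d)
      h₁ e = c₁ (τ-equal⇒C-equal a (a ⊕ d) πa≡x₀ πb≡x₀ (trans e (cong τ (sym q-second))))
      h₂ : τ (q a) ≢ τ ((q a ⊕ q d) ⊕ q d)
      h₂ e = c₂ (τ-equal⇒C-equal a ((a ⊕ d) ⊕ d) πa≡x₀ πc≡x₀ (trans e (cong τ (sym q-third))))
      h₃ : τ (q a ⊕ q d) ≢ τ ((q a ⊕ q d) ⊕ q d)
      h₃ e = c₃ (τ-equal⇒C-equal (a ⊕ d) ((a ⊕ d) ⊕ d) πb≡x₀ πc≡x₀
                   (trans (cong τ q-second) (trans e (cong τ (sym q-third)))))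

  C-free : ¬ HasRainbow3AP τ → ¬ HasRainbow3AP C
  C-free τ-free (a , d , ap , distinct) with toℕ (π d) ≟ 0
  ... | no πd≢0  = transversal-rainbow a d πd≢0 distinct
  ... | yes πd≡0 = fibre-rainbow τ-free a d πd≡0 ap distinct

-- The blow-up in contrapositive form: if R + K colours force a rainbow 3-AP in
-- ℤ_st, then R colours force one in ℤ_t.
blow-up : ∀ m t .{{_ : NonZero t}} {K R} (σ : Fin (suc (2 * m)) → Fin (suc K)) →
  Exact σ → ¬ HasRainbow3AP σ → (x₀ : Fin (suc (2 * m))) → (∀ y → σ y ≡ σ x₀ → y ≡ x₀) →
  AllRainbow (suc (2 * m) * t) (R + K) → AllRainbow t R
blow-up m t σ σ-exact σ-free x₀ σ-singleton all-st τ τ-exact with HasRainbow3AP? τ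
... | yes rainbow = rainbow
... | no τ-free = ⊥-elim (C-free τ-free (all-st C (C-exact τ-exact)))
  where open BlowUp m t σ σ-exact σ-free x₀ σ-singleton τ

-- The only degenerate case s·t < 3 is s = 1, t = 2, where every aw is n + 1.
degenerate-case : ∀ m t {aws awt awst} → 2 ≤ t → suc (2 * m) * t < 3 →
  IsAW (suc (2 * m)) aws → IsAW t awt → IsAW (suc (2 * m) * t) awst → awt + aws ≤ awst + 2
degenerate-case zero t _ t<3 (small-s , _) (small-t , _) (small-st , _)
  rewrite small-s (s≤s (s≤s z≤n)) | small-t (subst (_< 3) (+-identityʳ t) t<3) | small-st t<3
  = ≤-reflexive (cong (λ x → suc x + 2) (sym (+-identityʳ t)))
degenerate-case (suc m) t 2≤t st<3 _ _ _ =
  ⊥-elim (<⇒≱ st<3 (*-mono-≤ {3} {suc (2 * suc m)} {1} {t}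
                      (s≤s (*-monoʳ-≤ 2 (s≤s z≤n))) (≤-trans (s≤s z≤n) 2≤t)))

colour-count : ∀ a b K → a + 2 < b + suc (suc K) → a ≤ b ∸ 1 + K
colour-count a b K lt = drop-one b (≤-pred (≤-pred (subst₂ _<_ (+-comm a 2) b+K+2 lt)))
  where
  b+K+2 : b + suc (suc K) ≡ suc (suc (b + K))
  b+K+2 = trans (+-suc b (suc K)) (cong suc (+-suc b K))
  drop-one : ∀ b → a < b + K → a ≤ b ∸ 1 + K
  drop-one zero    a<K = <⇒≤ a<K
  drop-one (suc b) a<  = ≤-pred a<

-- Only k = aw(ℤ_s,3) ≥ 2 occurs, as the extremal colouring takes a value in
-- Fin (k ∸ 1).  If s·t ≥ 3 and awst + 2 < awt + aws, then awst colours, hence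
-- (awt − 1) + (aws − 2) colours, force rainbow 3-APs in ℤ_st; the blow-up then
-- makes awt − 1 colours force them in ℤ_t, contradicting the minimality of awt.
proposition3p14 : (s : ℕ) → Odd s → HasSingletonExtremal s →
    (t : ℕ) → 2 ≤ t →
    (aws awt awst : ℕ) → IsAW s aws → IsAW t awt → IsAW (s * t) awst →
    awt + aws ≤ awst + 2
proposition3p14 s (m , refl) (suc (suc K) , Hk , σ , (σ-exact , σ-free) , _ , x₀ , σx₀≡j , singleton)
  (suc t′) 2≤t aws awt awst Hs Ht Hst with 3 ≤? s * suc t′
... | no st≱3 = degenerate-case m (suc t′) 2≤t (≰⇒> st≱3) Hs Ht Hst
... | yes st≥3 = ≮⇒≥ λ too-small →
  let (1≤awst , all-st , _) = proj₂ Hst st≥3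
      aws≡K+2 = aw-unique Hs Hk
      awst≤R+K = colour-count awst awt K (subst (λ k → awst + 2 < awt + k) aws≡K+2 too-small)
  in ¬AllRainbow-below-aw (suc t′) 2≤t Ht
       (blow-up m (suc t′) σ σ-exact σ-free x₀ (λ y e → singleton y (trans e σx₀≡j))
         (AllRainbow-mono 1≤awst awst≤R+K all-st))
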